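{- Let $p$ be an odd prime and $d\ge1$. Let $e_1,\dots,e_d$ and $f_1,\dots,f_d$ be the standard bases of the first and second factors of $\mathbb{Z}_p^d\times\mathbb{Z}_p^d$, and let $S=A\cup B$ with $$A=\Big\{\big(\textstyle\sum_{i=1}^{k}e_i,\ \sum_{j=1}^{k-1}f_j\big): 1\le k\le d\Big\},\quad B=\Big\{\big(\textstyle\sum_{i=1}^{k-1}e_i+2e_k,\ \sum_{j=1}^{k}f_j\big): 1\le k\le d\Big\}.$$ Let $\epsilon(\bar a,\bar b)=(\bar a,\bar b,0)\in\mathbb{Z}_p^d\times\mathbb{Z}_p^d\times\mathbb{Z}_p$. Then: (a) $S$ is a basis of the vector space $\mathbb{Z}_p^{2d}=\mathbb{Z}_p^d\times\mathbb{Z}_p^d$; (b) no two distinct elements of $\epsilon(S)$ commute, both with respect to the multiplication $(\bar a,\bar b,z)(\bar c,\bar d,w)=(\bar a+\bar c,\bar b+\bar d,z+w+\bar b\cdot\bar c)$ and with respect to the multiplication $(\bar a,\bar b,z)(\bar c,\bar d,w)=(\bar a+\bar c,\bar b+\bar d,z+w+\bar b\cdot\bar c+\phi(a_1,c_1))$.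
   Context: In the second multiplication, $a_1,c_1$ are the first coordinates of $\bar a,\bar c$, and $\phi(x,y)=1$ if $\iota(x)+\iota(y)\ge p$ and $0$ otherwise, where $\iota:\mathbb{Z}_p\to\{0,\dots,p-1\}\subset\mathbb{Z}$ is the natural representative map. Both multiplications make $\mathbb{Z}_p^d\times\mathbb{Z}_p^d\times\mathbb{Z}_p$ into a group. -}

module Defs where

open import Data.Nat using (ℕ; zero; suc; _+_; _*_; _<ᵇ_; _≤ᵇ_; _≡ᵇ_; NonZero)
open import Data.Nat.DivMod using (_mod_)
open import Data.Fin using (Fin; toℕ; splitAt)
open import Data.Vec using (Vec; []; _∷_; zipWith; replicate; tabulate; map; foldr)
open import Data.Product using (_×_; _,_; ∃)
open import Data.Sum using ([_,_]′)
open import Data.Bool using (if_then_else_)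
open import Relation.Binary.PropositionalEquality using (_≡_; _≢_)

module _ (p : ℕ) .{{_ : NonZero p}} where

  Zp : Set
  Zp = Fin p

  ι : Zp → ℕ
  ι = toℕ

  [_]ₚ : ℕ → Zp
  [ n ]ₚ = n mod p

  _+ₚ_ : Zp → Zp → Zp
  x +ₚ y = [ toℕ x + toℕ y ]ₚ

  _*ₚ_ : Zp → Zp → Zp
  x *ₚ y = [ toℕ x * toℕ y ]ₚ

  V : ℕ → Set
  V d = Vec Zp d

  _+ᵥ_ : ∀ {d} → V d → V d → V d
  _+ᵥ_ = zipWith _+ₚ_

  _·ᵥ_ : ∀ {d} → Zp → V d → V d
  c ·ᵥ v = map (c *ₚ_) v

  0ᵥ : ∀ {d} → V d
  0ᵥ = replicate _ [ 0 ]ₚ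

  dot : ∀ {d} → V d → V d → Zp
  dot b c = foldr _ _+ₚ_ [ 0 ]ₚ (zipWith _*ₚ_ b c)

  -- standard basis vector e_k (0-based index k, i.e. e_{k+1} in the paper)
  e : ∀ {d} → Fin d → V d
  e k = tabulate (λ i → if toℕ i ≡ᵇ toℕ k then [ 1 ]ₚ else [ 0 ]ₚ)

  Σᵥ : ∀ {d m} → (Fin m → V d) → V d
  Σᵥ {d} {m} f = foldr _ _+ᵥ_ 0ᵥ (tabulate f)

  -- Σ_{i=1}^{k} e_i  (1-based in the paper), i.e. the sum of e i over 0-based i < k
  sumE : ∀ {d} → ℕ → V d
  sumE k = Σᵥ (λ i → if toℕ i <ᵇ k then e i else 0ᵥ)

  W : ℕ → Set
  W d = V d × V d

  _+w_ : ∀ {d} → W d → W d → W d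
  (a , b) +w (c , d) = (a +ᵥ c , b +ᵥ d)

  _·w_ : ∀ {d} → Zp → W d → W d
  c ·w (a , b) = (c ·ᵥ a , c ·ᵥ b)

  0w : ∀ {d} → W d
  0w = (0ᵥ , 0ᵥ)

  Σw : ∀ {d m} → (Fin m → W d) → W d
  Σw {d} {m} f = foldr _ _+w_ 0w (tabulate f)

  LinIndep : ∀ {d m} → (Fin m → W d) → Set
  LinIndep g = ∀ (c : Fin _ → Zp) → Σw (λ i → c i ·w g i) ≡ 0w → ∀ i → c i ≡ [ 0 ]ₚ

  Spans : ∀ {d m} → (Fin m → W d) → Set
  Spans {d} g = ∀ (v : W d) → ∃ λ (c : Fin _ → Zp) → Σw (λ i → c i ·w g i) ≡ v

  IsBasis : ∀ {d m} → (Fin m → W d) → Set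
  IsBasis g = LinIndep g × Spans g

  -- the sets A and B, indexed by 0-based k : Fin d (paper's k = toℕ k + 1)
  -- A_k = (Σ_{i=1}^{k} e_i , Σ_{j=1}^{k-1} f_j)
  Aelt : ∀ {d} → Fin d → W d
  Aelt k = (sumE (suc (toℕ k)) , sumE (toℕ k))

  Belt : ∀ {d} → Fin d → W d
  Belt k = (sumE (toℕ k) +ᵥ ([ 2 ]ₚ ·ᵥ e k) , sumE (suc (toℕ k)))

  Sfam : ∀ {d} → Fin (d + d) → W d
  Sfam {d} i = [ Aelt , Belt ]′ (splitAt d i)

  InS : ∀ {d} → W d → Set
  InS {d} x = ∃ λ (i : Fin (d + d)) → Sfam i ≡ x

  H : ℕ → Set
  H d = V d × V d × Zp

  ε : ∀ {d} → W d → H d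
  ε (a , b) = (a , b , [ 0 ]ₚ)

  mul₁ : ∀ {d} → H d → H d → H d
  mul₁ (a , b , z) (c , d , w) = (a +ᵥ c , b +ᵥ d , (z +ₚ w) +ₚ dot b c)

  φ : Zp → Zp → Zp
  φ x y = if p ≤ᵇ ι x + ι y then [ 1 ]ₚ else [ 0 ]ₚ

  -- first coordinate (only used for d ≥ 1; the value 0 for d = 0 is an irrelevant convention)
  first : ∀ {d} → V d → Zp
  first []      = [ 0 ]ₚ
  first (x ∷ _) = x

  mul₂ : ∀ {d} → H d → H d → H d
  mul₂ (a , b , z) (c , d , w) =
    (a +ᵥ c , b +ᵥ d , ((z +ₚ w) +ₚ dot b c) +ₚ φ (first a) (first c))

  NoTwoCommute : ∀ {d} → (H d → H d → H d) → Set
  NoTwoCommute {d} _∙_ = ∀ (x y : W d) → InS x → InS y → ε x ≢ ε y → (ε x ∙ ε y) ≢ (ε y ∙ ε x)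

-- Every element of S is a "staircase" pair: A_k = (1…1 1 0…0, 1…1 0 0…0) and
-- B_k = (1…1 2 0…0, 1…1 1 0…0), with the step in position k. For coefficients α on A and
-- β on B, coordinate j of the combination is X_j + β_j + (α_j + β_j) in the first factor and
-- X_j + β_j in the second, where X_j = Σ_{k>j} (α_k + β_k). This triangular system has a
-- unique solution for every right-hand side, so S is a basis.
-- For distinct x, y ∈ S with steps at k ≤ l, the products b_y,i a_x,i and b_x,i a_y,i agree
-- for every i except i = k, where they differ by exactly 1. Hence the central coordinates of
-- ε x ε y and ε y ε x differ by 1 ≠ 0, for both multiplications since φ is symmetric.

module Submission where

open import Defs
open import Algebra.Bundles using (CommutativeRing)
import Algebra.Definitions
import Algebra.Properties.Ring
import Algebra.Properties.Semiring.Sum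
open import Data.Bool using (Bool; true; false; if_then_else_)
open import Data.Fin using (Fin; zero; suc; toℕ; _↑ˡ_; _↑ʳ_; splitAt)
open import Data.Fin.Properties
  using (toℕ-injective; toℕ-fromℕ<; toℕ<n; splitAt-↑ˡ; splitAt-↑ʳ; splitAt⁻¹-↑ˡ; splitAt⁻¹-↑ʳ)
open import Data.Maybe using (nothing)
open import Data.Nat as ℕ using (ℕ; zero; suc; NonZero; _∸_; _%_; _<_; _≤_; _<ᵇ_; _≡ᵇ_; nonTrivial⇒n>1)
import Data.Nat.Properties as ℕ
open import Data.Nat.DivMod using (%-distribˡ-+; %-distribˡ-*; m<n⇒m%n≡m; n%n≡0)
open import Data.Nat.Divisibility using (_∣_)
open import Data.Nat.Primality using (Prime; prime⇒nonTrivial)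
open import Data.Product using (_×_; _,_; proj₁; proj₂; ∃; ∃₂)
open import Data.Sum using (_⊎_; inj₁; inj₂; [_,_]′)
open import Data.Vec using (lookup; tabulate)
open import Data.Vec.Properties using (lookup∘tabulate; tabulate∘lookup; tabulate-cong; lookup-zipWith; lookup-map; lookup-replicate)
open import Data.Empty using (⊥-elim)
open import Function using (_∘_)
open import Level using (0ℓ)
open import Relation.Binary.Definitions using (tri<; tri≈; tri>)
open import Relation.Binary.PropositionalEquality
open import Relation.Nullary using (¬_)
open import Relation.Nullary.Decidable using (dec-true; dec-false)
open import Tactic.RingSolver.Core.AlmostCommutativeRing using (fromCommutativeRing)

↑-induction : ∀ {m n} {P : Fin (m ℕ.+ n) → Set} → (∀ k → P (k ↑ˡ n)) → (∀ k → P (m ↑ʳ k)) → ∀ i → P i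
↑-induction {m} {P = P} left right i with splitAt m i in eq
... | inj₁ k = subst P (splitAt⁻¹-↑ˡ eq) (left k)
... | inj₂ k = subst P (splitAt⁻¹-↑ʳ eq) (right k)

-- Arithmetic modulo p

module Modular (p : ℕ) .{{_ : NonZero p}} where

  infixl 6 _⊕_
  infixl 7 _⊗_
  _⊕_ _⊗_ : Zp p → Zp p → Zp p
  _⊕_ = _+ₚ_ p
  _⊗_ = _*ₚ_ p

  ⟦_⟧ : ℕ → Zp p
  ⟦_⟧ = [_]ₚ p

  ⊖_ : Zp p → Zp p
  ⊖ x = ⟦ p ∸ toℕ x ⟧

  toℕ-⟦⟧ : ∀ n → toℕ ⟦ n ⟧ ≡ n % p
  toℕ-⟦⟧ n = toℕ-fromℕ< _

  ⟦⟧-≡ : ∀ {m n} → m % p ≡ n % p → ⟦ m ⟧ ≡ ⟦ n ⟧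
  ⟦⟧-≡ {m} {n} eq = toℕ-injective (trans (toℕ-⟦⟧ m) (trans eq (sym (toℕ-⟦⟧ n))))

  ⟦toℕ⟧ : ∀ x → ⟦ toℕ x ⟧ ≡ x
  ⟦toℕ⟧ x = toℕ-injective (trans (toℕ-⟦⟧ (toℕ x)) (m<n⇒m%n≡m (toℕ<n x)))

  ⟦⟧-+ : ∀ m n → ⟦ m ⟧ ⊕ ⟦ n ⟧ ≡ ⟦ m ℕ.+ n ⟧
  ⟦⟧-+ m n = ⟦⟧-≡ (trans (cong₂ (λ a b → (a ℕ.+ b) % p) (toℕ-⟦⟧ m) (toℕ-⟦⟧ n)) (sym (%-distribˡ-+ m n p)))

  ⟦⟧-* : ∀ m n → ⟦ m ⟧ ⊗ ⟦ n ⟧ ≡ ⟦ m ℕ.* n ⟧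
  ⟦⟧-* m n = ⟦⟧-≡ (trans (cong₂ (λ a b → (a ℕ.* b) % p) (toℕ-⟦⟧ m) (toℕ-⟦⟧ n)) (sym (%-distribˡ-* m n p)))

  open Algebra.Definitions {A = Zp p} _≡_

  -- every element is the image of its representative, so identities lift from ℕ
  lift₁ : {P : Zp p → Set} → (∀ m → P ⟦ m ⟧) → ∀ x → P x
  lift₁ {P} f x = subst P (⟦toℕ⟧ x) (f (toℕ x))

  lift₂ : {P : Zp p → Zp p → Set} → (∀ m n → P ⟦ m ⟧ ⟦ n ⟧) → ∀ x y → P x y
  lift₂ {P} f x = lift₁ {λ x → ∀ y → P x y} (λ m → lift₁ (f m)) x

  lift₃ : {P : Zp p → Zp p → Zp p → Set} → (∀ m n o → P ⟦ m ⟧ ⟦ n ⟧ ⟦ o ⟧) → ∀ x y z → P x y z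
  lift₃ {P} f x = lift₁ {λ x → ∀ y z → P x y z} (λ m → lift₂ (f m)) x

  ⊕-comm : Commutative _⊕_
  ⊕-comm x y = cong ⟦_⟧ (ℕ.+-comm (toℕ x) (toℕ y))

  ⊗-comm : Commutative _⊗_
  ⊗-comm x y = cong ⟦_⟧ (ℕ.*-comm (toℕ x) (toℕ y))

  ⊕-assoc : Associative _⊕_
  ⊕-assoc = lift₃ λ m n o → begin
    ⟦ m ⟧ ⊕ ⟦ n ⟧ ⊕ ⟦ o ⟧     ≡⟨ cong (_⊕ ⟦ o ⟧) (⟦⟧-+ m n) ⟩
    ⟦ m ℕ.+ n ⟧ ⊕ ⟦ o ⟧       ≡⟨ ⟦⟧-+ (m ℕ.+ n) o ⟩
    ⟦ m ℕ.+ n ℕ.+ o ⟧         ≡⟨ cong ⟦_⟧ (ℕ.+-assoc m n o) ⟩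
    ⟦ m ℕ.+ (n ℕ.+ o) ⟧       ≡⟨ ⟦⟧-+ m (n ℕ.+ o) ⟨
    ⟦ m ⟧ ⊕ ⟦ n ℕ.+ o ⟧       ≡⟨ cong (⟦ m ⟧ ⊕_) (⟦⟧-+ n o) ⟨
    ⟦ m ⟧ ⊕ (⟦ n ⟧ ⊕ ⟦ o ⟧)   ∎
    where open ≡-Reasoning

  ⊗-assoc : Associative _⊗_
  ⊗-assoc = lift₃ λ m n o → begin
    ⟦ m ⟧ ⊗ ⟦ n ⟧ ⊗ ⟦ o ⟧     ≡⟨ cong (_⊗ ⟦ o ⟧) (⟦⟧-* m n) ⟩
    ⟦ m ℕ.* n ⟧ ⊗ ⟦ o ⟧       ≡⟨ ⟦⟧-* (m ℕ.* n) o ⟩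
    ⟦ m ℕ.* n ℕ.* o ⟧         ≡⟨ cong ⟦_⟧ (ℕ.*-assoc m n o) ⟩
    ⟦ m ℕ.* (n ℕ.* o) ⟧       ≡⟨ ⟦⟧-* m (n ℕ.* o) ⟨
    ⟦ m ⟧ ⊗ ⟦ n ℕ.* o ⟧       ≡⟨ cong (⟦ m ⟧ ⊗_) (⟦⟧-* n o) ⟨
    ⟦ m ⟧ ⊗ (⟦ n ⟧ ⊗ ⟦ o ⟧)   ∎
    where open ≡-Reasoning

  ⊗-distribˡ-⊕ : _⊗_ DistributesOverˡ _⊕_
  ⊗-distribˡ-⊕ = lift₃ λ m n o → begin
    ⟦ m ⟧ ⊗ (⟦ n ⟧ ⊕ ⟦ o ⟧)          ≡⟨ cong (⟦ m ⟧ ⊗_) (⟦⟧-+ n o) ⟩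
    ⟦ m ⟧ ⊗ ⟦ n ℕ.+ o ⟧              ≡⟨ ⟦⟧-* m (n ℕ.+ o) ⟩
    ⟦ m ℕ.* (n ℕ.+ o) ⟧              ≡⟨ cong ⟦_⟧ (ℕ.*-distribˡ-+ m n o) ⟩
    ⟦ m ℕ.* n ℕ.+ m ℕ.* o ⟧          ≡⟨ ⟦⟧-+ (m ℕ.* n) (m ℕ.* o) ⟨
    ⟦ m ℕ.* n ⟧ ⊕ ⟦ m ℕ.* o ⟧        ≡⟨ cong₂ _⊕_ (⟦⟧-* m n) (⟦⟧-* m o) ⟨
    ⟦ m ⟧ ⊗ ⟦ n ⟧ ⊕ ⟦ m ⟧ ⊗ ⟦ o ⟧    ∎
    where open ≡-Reasoning

  ⊗-distribʳ-⊕ : _⊗_ DistributesOverʳ _⊕_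
  ⊗-distribʳ-⊕ x y z = trans (⊗-comm (y ⊕ z) x) (trans (⊗-distribˡ-⊕ x y z) (cong₂ _⊕_ (⊗-comm x y) (⊗-comm x z)))

  ⊕-identityˡ : LeftIdentity ⟦ 0 ⟧ _⊕_
  ⊕-identityˡ = lift₁ (⟦⟧-+ 0)

  ⊕-identityʳ : RightIdentity ⟦ 0 ⟧ _⊕_
  ⊕-identityʳ x = trans (⊕-comm x _) (⊕-identityˡ x)

  ⊗-identityˡ : LeftIdentity ⟦ 1 ⟧ _⊗_
  ⊗-identityˡ = lift₁ λ m → trans (⟦⟧-* 1 m) (cong ⟦_⟧ (ℕ.*-identityˡ m))

  ⊗-identityʳ : RightIdentity ⟦ 1 ⟧ _⊗_
  ⊗-identityʳ x = trans (⊗-comm x _) (⊗-identityˡ x)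

  ⊖-inverseˡ : LeftInverse ⟦ 0 ⟧ ⊖_ _⊕_
  ⊖-inverseˡ x = begin
    ⟦ p ∸ toℕ x ⟧ ⊕ x              ≡⟨ cong (⟦ p ∸ toℕ x ⟧ ⊕_) (⟦toℕ⟧ x) ⟨
    ⟦ p ∸ toℕ x ⟧ ⊕ ⟦ toℕ x ⟧      ≡⟨ ⟦⟧-+ (p ∸ toℕ x) (toℕ x) ⟩
    ⟦ p ∸ toℕ x ℕ.+ toℕ x ⟧        ≡⟨ cong ⟦_⟧ (ℕ.m∸n+n≡m (ℕ.<⇒≤ (toℕ<n x))) ⟩
    ⟦ p ⟧                          ≡⟨ ⟦⟧-≡ (trans (n%n≡0 p) (sym (m<n⇒m%n≡m (ℕ.>-nonZero⁻¹ p)))) ⟩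
    ⟦ 0 ⟧                          ∎
    where open ≡-Reasoning

  ℤ/pℤ : CommutativeRing 0ℓ 0ℓ
  ℤ/pℤ = record
    { isCommutativeRing = record
      { isRing = record
        { +-isAbelianGroup = record
          { isGroup = record
            { isMonoid = record
              { isSemigroup = record
                { isMagma = record { isEquivalence = isEquivalence ; ∙-cong = cong₂ _⊕_ }
                ; assoc = ⊕-assoc }
              ; identity = ⊕-identityˡ , ⊕-identityʳ }
            ; inverse = ⊖-inverseˡ , λ x → trans (⊕-comm x _) (⊖-inverseˡ x)
            ; ⁻¹-cong = cong ⊖_ }
          ; comm = ⊕-comm }
        ; *-cong = cong₂ _⊗_
        ; *-assoc = ⊗-assoc
        ; *-identity = ⊗-identityˡ , ⊗-identityʳ
        ; distrib = ⊗-distribˡ-⊕ , ⊗-distribʳ-⊕ }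
      ; *-comm = ⊗-comm } }


module _ (p : ℕ) .{{_ : NonZero p}} where

  open Modular p using (ℤ/pℤ; ⟦_⟧; ⟦⟧-+; toℕ-⟦⟧)
  open CommutativeRing ℤ/pℤ
    using (_+_; _*_; -_; _-_; 0#; 1#; +-identityˡ; +-identityʳ; *-identityˡ; *-identityʳ; zeroˡ; zeroʳ; +-assoc; +-comm; distribˡ; -‿inverseˡ; -‿inverseʳ; ring; semiring)
  open Algebra.Properties.Ring ring using (+-cancelˡ; +-cancelʳ)
  open Algebra.Properties.Semiring.Sum semiring using (sum; sum-cong-≗; ∑-distrib-+; sum-replicate-zero)
  open import Tactic.RingSolver.NonReflective (fromCommutativeRing ℤ/pℤ (λ _ → nothing))
    using (solve; _⊕_; _⊗_; _⊜_)

  2# : Zp p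
  2# = ⟦ 2 ⟧

  2≡1+1 : 2# ≡ 1# + 1#
  2≡1+1 = sym (⟦⟧-+ 1 1)

  1≢0 : 1 < p → 1# ≢ 0#
  1≢0 1<p 1≡0 = ℕ.1+n≢0 (begin
    1         ≡⟨ m<n⇒m%n≡m 1<p ⟨
    1 % p     ≡⟨ toℕ-⟦⟧ 1 ⟨
    toℕ 1#    ≡⟨ cong toℕ 1≡0 ⟩
    toℕ 0#    ≡⟨ toℕ-⟦⟧ 0 ⟩
    0 % p     ≡⟨ m<n⇒m%n≡m (ℕ.>-nonZero⁻¹ p) ⟩
    0         ∎)
    where open ≡-Reasoning

  -+-cancel : ∀ x y → x - y + y ≡ x
  -+-cancel x y = trans (+-assoc x (- y) y) (trans (cong (x +_) (-‿inverseˡ y)) (+-identityʳ x))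

  +--cancel : ∀ x y → x + (y - x) ≡ y
  +--cancel x y = begin
    x + (y - x)    ≡⟨ cong (x +_) (+-comm y (- x)) ⟩
    x + (- x + y)  ≡⟨ +-assoc x (- x) y ⟨
    x - x + y      ≡⟨ cong (_+ y) (-‿inverseʳ x) ⟩
    0# + y         ≡⟨ +-identityˡ y ⟩
    y              ∎
    where open ≡-Reasoning

  sum-zero : ∀ {n} {f : Fin n → Zp p} → (∀ i → f i ≡ 0#) → sum f ≡ 0#
  sum-zero {n} f≗0 = trans (sum-cong-≗ f≗0) (sum-replicate-zero n)

  sum-↑ : ∀ m {n} (f : Fin (m ℕ.+ n) → Zp p) → sum f ≡ sum (f ∘ (_↑ˡ n)) + sum (f ∘ (m ↑ʳ_))
  sum-↑ zero    f = sym (+-identityˡ (sum f))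
  sum-↑ (suc m) f = trans (cong (f zero +_) (sum-↑ m (f ∘ suc))) (sym (+-assoc (f zero) _ _))

  𝟙 : Bool → Zp p
  𝟙 b = if b then 1# else 0#

  δ : ∀ {d} → Fin d → Fin d → Zp p
  δ i j = 𝟙 (toℕ i ≡ᵇ toℕ j)

  δ-refl : ∀ {d} (i : Fin d) → δ i i ≡ 1#
  δ-refl i = cong 𝟙 (dec-true (toℕ i ℕ.≟ toℕ i) refl)

  δ-≢ : ∀ {d} {i j : Fin d} → toℕ i ≢ toℕ j → δ i j ≡ 0#
  δ-≢ {i = i} {j} i≢j = cong 𝟙 (dec-false (toℕ i ℕ.≟ toℕ j) i≢j)

  sum-δ : ∀ {d} (j : Fin d) (x : Fin d → Zp p) → sum (λ k → δ j k * x k) ≡ x j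
  sum-δ {suc d} zero x = begin
    1# * x zero + sum (λ k → 0# * x (suc k))  ≡⟨ cong₂ _+_ (*-identityˡ (x zero)) (sum-zero (zeroˡ ∘ x ∘ suc)) ⟩
    x zero + 0#                               ≡⟨ +-identityʳ (x zero) ⟩
    x zero                                    ∎
    where open ≡-Reasoning
  sum-δ {suc d} (suc j) x = trans (cong₂ _+_ (zeroˡ (x zero)) (sum-δ j (x ∘ suc))) (+-identityˡ (x (suc j)))

  -- Staircase vectors

  stair : ∀ {d} → Zp p → Fin d → Fin d → Zp p
  stair s k i = 𝟙 (toℕ i <ᵇ toℕ k) + s * δ i k

  stairs : ∀ {d} → Zp p → Zp p → Fin d → W p d
  stairs s t k = tabulate (stair s k) , tabulate (stair t k)

  stair-below : ∀ {d} s {k i : Fin d} → toℕ i < toℕ k → stair s k i ≡ 1#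
  stair-below s {k} {i} i<k = begin
    𝟙 (toℕ i <ᵇ toℕ k) + s * δ i k  ≡⟨ cong₂ (λ b x → 𝟙 b + s * x) (dec-true (toℕ i ℕ.<? toℕ k) i<k) (δ-≢ (ℕ.<⇒≢ i<k)) ⟩
    1# + s * 0#                     ≡⟨ trans (cong (1# +_) (zeroʳ s)) (+-identityʳ 1#) ⟩
    1#                              ∎
    where open ≡-Reasoning

  stair-at : ∀ {d} s (k : Fin d) → stair s k k ≡ s
  stair-at s k = begin
    𝟙 (toℕ k <ᵇ toℕ k) + s * δ k k  ≡⟨ cong₂ (λ b x → 𝟙 b + s * x) (dec-false (toℕ k ℕ.<? toℕ k) (ℕ.<-irrefl refl)) (δ-refl k) ⟩
    0# + s * 1#                     ≡⟨ trans (+-identityˡ (s * 1#)) (*-identityʳ s) ⟩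
    s                               ∎
    where open ≡-Reasoning

  stair-above : ∀ {d} s {k i : Fin d} → toℕ k < toℕ i → stair s k i ≡ 0#
  stair-above s {k} {i} k<i = begin
    𝟙 (toℕ i <ᵇ toℕ k) + s * δ i k  ≡⟨ cong₂ (λ b x → 𝟙 b + s * x) (dec-false (toℕ i ℕ.<? toℕ k) (ℕ.<-asym k<i)) (δ-≢ (ℕ.>⇒≢ k<i)) ⟩
    0# + s * 0#                     ≡⟨ trans (+-identityˡ (s * 0#)) (zeroʳ s) ⟩
    0#                              ∎
    where open ≡-Reasoning

  lookup⇒≡tabulate : ∀ {d} {v : V p d} {f : Fin d → Zp p} → (∀ i → lookup v i ≡ f i) → v ≡ tabulate f
  lookup⇒≡tabulate {v = v} v≗f = trans (sym (tabulate∘lookup v)) (tabulate-cong v≗f)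

  lookup-ext : ∀ {d} {u v : V p d} → (∀ i → lookup u i ≡ lookup v i) → u ≡ v
  lookup-ext {v = v} u≗v = trans (lookup⇒≡tabulate u≗v) (tabulate∘lookup v)

  lookup-Σᵥ : ∀ {d m} (f : Fin m → V p d) j → lookup (Σᵥ p f) j ≡ sum (λ i → lookup (f i) j)
  lookup-Σᵥ {m = zero}  f j = lookup-replicate j 0#
  lookup-Σᵥ {m = suc m} f j = trans (lookup-zipWith _+_ j (f zero) _) (cong (lookup (f zero) j +_) (lookup-Σᵥ (f ∘ suc) j))

  proj₁-Σw : ∀ {d m} (f : Fin m → W p d) → proj₁ (Σw p f) ≡ Σᵥ p (proj₁ ∘ f)
  proj₁-Σw {m = zero}  f = refl
  proj₁-Σw {m = suc m} f = cong (_+ᵥ_ p (proj₁ (f zero))) (proj₁-Σw (f ∘ suc))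

  proj₂-Σw : ∀ {d m} (f : Fin m → W p d) → proj₂ (Σw p f) ≡ Σᵥ p (proj₂ ∘ f)
  proj₂-Σw {m = zero}  f = refl
  proj₂-Σw {m = suc m} f = cong (_+ᵥ_ p (proj₂ (f zero))) (proj₂-Σw (f ∘ suc))

  dot-tabulate : ∀ {d} (f g : Fin d → Zp p) → dot p (tabulate f) (tabulate g) ≡ sum (λ i → f i * g i)
  dot-tabulate {zero}  f g = refl
  dot-tabulate {suc d} f g = cong (f zero * g zero +_) (dot-tabulate (f ∘ suc) (g ∘ suc))

  𝟙-<ᵇ-suc : ∀ i k → 𝟙 (i <ᵇ suc k) ≡ 𝟙 (i <ᵇ k) + 𝟙 (i ≡ᵇ k)
  𝟙-<ᵇ-suc zero    zero    = sym (+-identityˡ 1#)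
  𝟙-<ᵇ-suc zero    (suc k) = sym (+-identityʳ 1#)
  𝟙-<ᵇ-suc (suc i) zero    = sym (+-identityˡ 0#)
  𝟙-<ᵇ-suc (suc i) (suc k) = 𝟙-<ᵇ-suc i k

  lookup-sumE : ∀ {d} m (j : Fin d) → lookup (sumE p m) j ≡ 𝟙 (toℕ j <ᵇ m)
  lookup-sumE m j = trans (lookup-Σᵥ (λ i → if toℕ i <ᵇ m then e p i else 0ᵥ p) j) (trans (sum-cong-≗ entry) (sum-δ j (λ i → 𝟙 (toℕ i <ᵇ m))))
    where
    entry : ∀ i → lookup (if toℕ i <ᵇ m then e p i else 0ᵥ p) j ≡ δ j i * 𝟙 (toℕ i <ᵇ m)
    entry i with toℕ i <ᵇ m
    ... | true  = trans (lookup∘tabulate (λ i′ → δ i′ i) j) (sym (*-identityʳ (δ j i)))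
    ... | false = trans (lookup-replicate j 0#) (sym (zeroʳ (δ j i)))

  sumE-stair₀ : ∀ {d} (k : Fin d) → sumE p (toℕ k) ≡ tabulate (stair 0# k)
  sumE-stair₀ k = lookup⇒≡tabulate λ i →
    trans (lookup-sumE (toℕ k) i) (sym (trans (cong (𝟙 (toℕ i <ᵇ toℕ k) +_) (zeroˡ (δ i k))) (+-identityʳ _)))

  sumE-stair₁ : ∀ {d} (k : Fin d) → sumE p (suc (toℕ k)) ≡ tabulate (stair 1# k)
  sumE-stair₁ k = lookup⇒≡tabulate λ i →
    trans (lookup-sumE (suc (toℕ k)) i) (trans (𝟙-<ᵇ-suc (toℕ i) (toℕ k)) (cong (𝟙 (toℕ i <ᵇ toℕ k) +_) (sym (*-identityˡ (δ i k)))))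

  Aelt-stairs : ∀ {d} (k : Fin d) → Aelt p k ≡ stairs 1# 0# k
  Aelt-stairs k = cong₂ _,_ (sumE-stair₁ k) (sumE-stair₀ k)

  Belt-stairs : ∀ {d} (k : Fin d) → Belt p k ≡ stairs 2# 1# k
  Belt-stairs k = cong₂ _,_ (lookup⇒≡tabulate entry) (sumE-stair₁ k)
    where
    entry : ∀ i → lookup (proj₁ (Belt p k)) i ≡ stair 2# k i
    entry i = begin
      lookup (proj₁ (Belt p k)) i                           ≡⟨ lookup-zipWith _+_ i (sumE p (toℕ k)) _ ⟩
      lookup (sumE p (toℕ k)) i + lookup (_·ᵥ_ p 2# (e p k)) i ≡⟨ cong₂ _+_ (lookup-sumE (toℕ k) i) (lookup-map i (2# *_) (e p k)) ⟩
      𝟙 (toℕ i <ᵇ toℕ k) + 2# * lookup (e p k) i            ≡⟨ cong (λ x → 𝟙 (toℕ i <ᵇ toℕ k) + 2# * x) (lookup∘tabulate (λ i′ → δ i′ k) i) ⟩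
      stair 2# k i                                          ∎
      where open ≡-Reasoning

  Sfam-↑ˡ : ∀ {d} (k : Fin d) → Sfam p (k ↑ˡ d) ≡ stairs 1# 0# k
  Sfam-↑ˡ {d} k = trans (cong [ Aelt p , Belt p ]′ (splitAt-↑ˡ d k d)) (Aelt-stairs k)

  Sfam-↑ʳ : ∀ {d} (k : Fin d) → Sfam p (d ↑ʳ k) ≡ stairs 2# 1# k
  Sfam-↑ʳ {d} k = trans (cong [ Aelt p , Belt p ]′ (splitAt-↑ʳ d d k)) (Belt-stairs k)

  -- The basis property

  sumAbove : ∀ {d} → (Fin d → Zp p) → Fin d → Zp p
  sumAbove γ j = sum (λ k → 𝟙 (toℕ j <ᵇ toℕ k) * γ k)

  sum-stairs : ∀ {d} (α β : Fin d → Zp p) s s′ (j : Fin d) →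
    sum (λ k → α k * stair s k j + β k * stair s′ k j) ≡ sumAbove (λ k → α k + β k) j + (α j * s + β j * s′)
  sum-stairs α β s s′ j = begin
    sum (λ k → α k * stair s k j + β k * stair s′ k j)
      ≡⟨ sum-cong-≗ (λ k → regroup (α k) (β k) (𝟙 (toℕ j <ᵇ toℕ k)) (δ j k) s s′) ⟩
    sum (λ k → 𝟙 (toℕ j <ᵇ toℕ k) * (α k + β k) + δ j k * (α k * s + β k * s′))
      ≡⟨ ∑-distrib-+ (λ k → 𝟙 (toℕ j <ᵇ toℕ k) * (α k + β k)) (λ k → δ j k * (α k * s + β k * s′)) ⟩
    sumAbove (λ k → α k + β k) j + sum (λ k → δ j k * (α k * s + β k * s′))
      ≡⟨ cong (sumAbove (λ k → α k + β k) j +_) (sum-δ j (λ k → α k * s + β k * s′)) ⟩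
    sumAbove (λ k → α k + β k) j + (α j * s + β j * s′) ∎
    where
    open ≡-Reasoning
    regroup : ∀ a b L D t t′ → a * (L + t * D) + b * (L + t′ * D) ≡ L * (a + b) + D * (a * t + b * t′)
    regroup = solve 6 (λ a b L D t t′ → (a ⊗ (L ⊕ t ⊗ D) ⊕ b ⊗ (L ⊕ t′ ⊗ D)) ⊜ (L ⊗ (a ⊕ b) ⊕ D ⊗ (a ⊗ t ⊕ b ⊗ t′))) refl

  lookup-Σᵥ-stairs : ∀ {d} (c : Fin (d ℕ.+ d) → Zp p) {α β : Fin d → Zp p} (g : Fin (d ℕ.+ d) → V p d) {s s′} →
    (∀ k → c (k ↑ˡ d) ≡ α k) → (∀ k → c (d ↑ʳ k) ≡ β k) →
    (∀ k → g (k ↑ˡ d) ≡ tabulate (stair s k)) → (∀ k → g (d ↑ʳ k) ≡ tabulate (stair s′ k)) →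
    ∀ j → lookup (Σᵥ p (λ i → _·ᵥ_ p (c i) (g i))) j ≡ sumAbove (λ k → α k + β k) j + (α j * s + β j * s′)
  lookup-Σᵥ-stairs {d} c {α} {β} g {s} {s′} cα cβ gA gB j = begin
    lookup (Σᵥ p (λ i → _·ᵥ_ p (c i) (g i))) j
      ≡⟨ lookup-Σᵥ (λ i → _·ᵥ_ p (c i) (g i)) j ⟩
    sum (λ i → lookup (_·ᵥ_ p (c i) (g i)) j)
      ≡⟨ sum-↑ d (λ i → lookup (_·ᵥ_ p (c i) (g i)) j) ⟩
    sum (λ k → lookup (_·ᵥ_ p (c (k ↑ˡ d)) (g (k ↑ˡ d))) j) + sum (λ k → lookup (_·ᵥ_ p (c (d ↑ʳ k)) (g (d ↑ʳ k))) j)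
      ≡⟨ cong₂ _+_ (sum-cong-≗ (entry {t = s} cα gA)) (sum-cong-≗ (entry {t = s′} cβ gB)) ⟩
    sum (λ k → α k * stair s k j) + sum (λ k → β k * stair s′ k j)
      ≡⟨ ∑-distrib-+ (λ k → α k * stair s k j) (λ k → β k * stair s′ k j) ⟨
    sum (λ k → α k * stair s k j + β k * stair s′ k j)
      ≡⟨ sum-stairs α β s s′ j ⟩
    sumAbove (λ k → α k + β k) j + (α j * s + β j * s′) ∎
    where
    open ≡-Reasoning
    entry : ∀ {a : Fin d → Zp p} {t} {ι : Fin d → Fin (d ℕ.+ d)} → (∀ k → c (ι k) ≡ a k) →
            (∀ k → g (ι k) ≡ tabulate (stair t k)) → ∀ k → lookup (_·ᵥ_ p (c (ι k)) (g (ι k))) j ≡ a k * stair t k j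
    entry {a} {t} {ι} ca ga k = begin
      lookup (_·ᵥ_ p (c (ι k)) (g (ι k))) j  ≡⟨ lookup-map j (c (ι k) *_) (g (ι k)) ⟩
      c (ι k) * lookup (g (ι k)) j           ≡⟨ cong₂ (λ x v → x * lookup v j) (ca k) (ga k) ⟩
      a k * lookup (tabulate (stair t k)) j  ≡⟨ cong (a k *_) (lookup∘tabulate (stair t k) j) ⟩
      a k * stair t k j                      ∎

  combination : ∀ {d} → (Fin (d ℕ.+ d) → Zp p) → W p d
  combination c = Σw p (λ i → _·w_ p (c i) (Sfam p i))

  module _ {d} (c : Fin (d ℕ.+ d) → Zp p) {α β : Fin d → Zp p}
           (cα : ∀ k → c (k ↑ˡ d) ≡ α k) (cβ : ∀ k → c (d ↑ʳ k) ≡ β k) (j : Fin d) where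

    private
      X : Zp p
      X = sumAbove (λ k → α k + β k) j

    lookup-combination₂ : lookup (proj₂ (combination c)) j ≡ X + β j
    lookup-combination₂ = begin
      lookup (proj₂ (combination c)) j  ≡⟨ cong (λ v → lookup v j) (proj₂-Σw (λ i → _·w_ p (c i) (Sfam p i))) ⟩
      _                                 ≡⟨ lookup-Σᵥ-stairs c (proj₂ ∘ Sfam p) cα cβ (cong proj₂ ∘ Sfam-↑ˡ) (cong proj₂ ∘ Sfam-↑ʳ) j ⟩
      X + (α j * 0# + β j * 1#)         ≡⟨ cong (X +_) (trans (cong₂ _+_ (zeroʳ (α j)) (*-identityʳ (β j))) (+-identityˡ (β j))) ⟩
      X + β j                           ∎
      where open ≡-Reasoning

    lookup-combination₁ : lookup (proj₁ (combination c)) j ≡ X + β j + (α j + β j)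
    lookup-combination₁ = begin
      lookup (proj₁ (combination c)) j  ≡⟨ cong (λ v → lookup v j) (proj₁-Σw (λ i → _·w_ p (c i) (Sfam p i))) ⟩
      _                                 ≡⟨ lookup-Σᵥ-stairs c (proj₁ ∘ Sfam p) cα cβ (cong proj₁ ∘ Sfam-↑ˡ) (cong proj₁ ∘ Sfam-↑ʳ) j ⟩
      X + (α j * 1# + β j * 2#)         ≡⟨ cong (λ t → X + (α j * 1# + β j * t)) 2≡1+1 ⟩
      X + (α j * 1# + β j * (1# + 1#))  ≡⟨ cong (λ t → X + (t + β j * (1# + 1#))) (*-identityʳ (α j)) ⟩
      X + (α j + β j * (1# + 1#))       ≡⟨ cong (λ t → X + (α j + t)) (trans (distribˡ (β j) 1# 1#) (cong₂ _+_ (*-identityʳ (β j)) (*-identityʳ (β j)))) ⟩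
      X + (α j + (β j + β j))           ≡⟨ solve 3 (λ x a b → (x ⊕ (a ⊕ (b ⊕ b))) ⊜ (x ⊕ b ⊕ (a ⊕ b))) refl X (α j) (β j) ⟩
      X + β j + (α j + β j)             ∎
      where open ≡-Reasoning

  linearlyIndependent : ∀ {d} → LinIndep p (Sfam p {d})
  linearlyIndependent {d} c c≡0 = ↑-induction α≡0 β≡0
    where
    open ≡-Reasoning
    α β : Fin d → Zp p
    α k = c (k ↑ˡ d)
    β k = c (d ↑ʳ k)
    X : Fin d → Zp p
    X = sumAbove (λ k → α k + β k)

    coordinate₁ : ∀ j → X j + β j + (α j + β j) ≡ 0#
    coordinate₁ j = trans (sym (lookup-combination₁ c (λ _ → refl) (λ _ → refl) j))
      (trans (cong (λ w → lookup (proj₁ w) j) c≡0) (lookup-replicate j 0#))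

    coordinate₂ : ∀ j → X j + β j ≡ 0#
    coordinate₂ j = trans (sym (lookup-combination₂ c (λ _ → refl) (λ _ → refl) j))
      (trans (cong (λ w → lookup (proj₂ w) j) c≡0) (lookup-replicate j 0#))

    α+β≡0 : ∀ j → α j + β j ≡ 0#
    α+β≡0 j = begin
      α j + β j               ≡⟨ +-identityˡ (α j + β j) ⟨
      0# + (α j + β j)        ≡⟨ cong (_+ (α j + β j)) (coordinate₂ j) ⟨
      X j + β j + (α j + β j) ≡⟨ coordinate₁ j ⟩
      0#                      ∎

    X≡0 : ∀ j → X j ≡ 0#
    X≡0 j = sum-zero (λ k → trans (cong (𝟙 (toℕ j <ᵇ toℕ k) *_) (α+β≡0 k)) (zeroʳ (𝟙 (toℕ j <ᵇ toℕ k))))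

    β≡0 : ∀ j → β j ≡ 0#
    β≡0 j = begin
      β j        ≡⟨ +-identityˡ (β j) ⟨
      0# + β j   ≡⟨ cong (_+ β j) (X≡0 j) ⟨
      X j + β j  ≡⟨ coordinate₂ j ⟩
      0#         ∎

    α≡0 : ∀ j → α j ≡ 0#
    α≡0 j = begin
      α j        ≡⟨ +-identityʳ (α j) ⟨
      α j + 0#   ≡⟨ cong (α j +_) (β≡0 j) ⟨
      α j + β j  ≡⟨ α+β≡0 j ⟩
      0#         ∎

  -- With D = a - b the coordinate equations force α + β = D, hence X = sumAbove D,
  -- and then β = b - X and α = D - β.
  spanning : ∀ {d} → Spans p (Sfam p {d})
  spanning {d} (a , b) = c , cong₂ _,_ (lookup-ext coordinate₁) (lookup-ext coordinate₂)
    where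
    open ≡-Reasoning
    D X α β : Fin d → Zp p
    D k = lookup a k - lookup b k
    X = sumAbove D
    β j = lookup b j - X j
    α j = D j - β j
    c : Fin (d ℕ.+ d) → Zp p
    c i = [ α , β ]′ (splitAt d i)

    cα : ∀ k → c (k ↑ˡ d) ≡ α k
    cα k = cong [ α , β ]′ (splitAt-↑ˡ d k d)
    cβ : ∀ k → c (d ↑ʳ k) ≡ β k
    cβ k = cong [ α , β ]′ (splitAt-↑ʳ d d k)

    α+β≡D : ∀ k → α k + β k ≡ D k
    α+β≡D k = -+-cancel (D k) (β k)

    sumAbove≡X : ∀ j → sumAbove (λ k → α k + β k) j ≡ X j
    sumAbove≡X j = sum-cong-≗ (λ k → cong (𝟙 (toℕ j <ᵇ toℕ k) *_) (α+β≡D k))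

    coordinate₂ : ∀ j → lookup (proj₂ (combination c)) j ≡ lookup b j
    coordinate₂ j = begin
      lookup (proj₂ (combination c)) j         ≡⟨ lookup-combination₂ c cα cβ j ⟩
      sumAbove (λ k → α k + β k) j + β j       ≡⟨ cong (_+ β j) (sumAbove≡X j) ⟩
      X j + (lookup b j - X j)                 ≡⟨ +--cancel (X j) (lookup b j) ⟩
      lookup b j                               ∎

    coordinate₁ : ∀ j → lookup (proj₁ (combination c)) j ≡ lookup a j
    coordinate₁ j = begin
      lookup (proj₁ (combination c)) j                   ≡⟨ lookup-combination₁ c cα cβ j ⟩
      sumAbove (λ k → α k + β k) j + β j + (α j + β j)   ≡⟨ cong₂ (λ x y → x + β j + y) (sumAbove≡X j) (α+β≡D j) ⟩
      X j + (lookup b j - X j) + (lookup a j - lookup b j)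
        ≡⟨ cong (_+ (lookup a j - lookup b j)) (+--cancel (X j) (lookup b j)) ⟩
      lookup b j + (lookup a j - lookup b j)             ≡⟨ +--cancel (lookup b j) (lookup a j) ⟩
      lookup a j                                         ∎

  -- Commutation

  -- the central coordinates of ε y ∙ ε x and ε x ∙ ε y differ by exactly 1
  CommutatorOne : ∀ {d} → W p d → W p d → Set
  CommutatorOne x y = dot p (proj₂ y) (proj₁ x) ≡ dot p (proj₂ x) (proj₁ y) + 1#

  stair-product : ∀ {d} {s t s′ t′} {k l : Fin d} → toℕ k ≤ toℕ l →
    stair t′ l k * s ≡ t * stair s′ l k + 1# →
    ∀ i → stair t′ l i * stair s k i ≡ stair t k i * stair s′ l i + δ k i
  stair-product {s = s} {t} {s′} {t′} {k} {l} k≤l at-k i with ℕ.<-cmp (toℕ i) (toℕ k)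
  ... | tri< i<k _ _ = begin
    stair t′ l i * stair s k i       ≡⟨ cong₂ _*_ (stair-below t′ i<l) (stair-below s i<k) ⟩
    1# * 1#                          ≡⟨ +-identityʳ (1# * 1#) ⟨
    1# * 1# + 0#                     ≡⟨ cong₂ _+_ (cong₂ _*_ (stair-below t i<k) (stair-below s′ i<l)) (δ-≢ (ℕ.>⇒≢ i<k)) ⟨
    stair t k i * stair s′ l i + δ k i ∎
    where
    open ≡-Reasoning
    i<l = ℕ.<-≤-trans i<k k≤l
  ... | tri≈ _ i≡k _ rewrite toℕ-injective i≡k | stair-at s k | stair-at t k | δ-refl k = at-k
  ... | tri> _ _ k<i = begin
    stair t′ l i * stair s k i       ≡⟨ cong (stair t′ l i *_) (stair-above s k<i) ⟩
    stair t′ l i * 0#                ≡⟨ zeroʳ (stair t′ l i) ⟩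
    0#                               ≡⟨ trans (cong (_+ 0#) (zeroˡ (stair s′ l i))) (+-identityʳ 0#) ⟨
    0# * stair s′ l i + 0#           ≡⟨ cong₂ _+_ (cong (_* stair s′ l i) (stair-above t k<i)) (δ-≢ (ℕ.<⇒≢ k<i)) ⟨
    stair t k i * stair s′ l i + δ k i ∎
    where open ≡-Reasoning

  stairs-CommutatorOne : ∀ {d} {s t s′ t′} {k l : Fin d} → toℕ k ≤ toℕ l →
    stair t′ l k * s ≡ t * stair s′ l k + 1# → CommutatorOne (stairs s t k) (stairs s′ t′ l)
  stairs-CommutatorOne {s = s} {t} {s′} {t′} {k} {l} k≤l at-k = begin
    dot p (tabulate (stair t′ l)) (tabulate (stair s k))  ≡⟨ dot-tabulate (stair t′ l) (stair s k) ⟩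
    sum (λ i → stair t′ l i * stair s k i)                ≡⟨ sum-cong-≗ (stair-product {s = s} {t} {s′} {t′} k≤l at-k) ⟩
    sum (λ i → stair t k i * stair s′ l i + δ k i)        ≡⟨ ∑-distrib-+ (λ i → stair t k i * stair s′ l i) (δ k) ⟩
    sum (λ i → stair t k i * stair s′ l i) + sum (δ k)    ≡⟨ cong₂ _+_ (sym (dot-tabulate (stair t k) (stair s′ l))) sum-δk ⟩
    dot p (tabulate (stair t k)) (tabulate (stair s′ l)) + 1# ∎
    where
    open ≡-Reasoning
    sum-δk : sum (δ k) ≡ 1#
    sum-δk = trans (sum-cong-≗ (λ i → sym (*-identityʳ (δ k i)))) (sum-δ k (λ _ → 1#))

  data Diagonal : Zp p → Zp p → Set where
    A-diagonal : Diagonal 1# 0#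
    B-diagonal : Diagonal 2# 1#

  diagonal-suc : ∀ {s t} → Diagonal s t → s ≡ t + 1#
  diagonal-suc A-diagonal = sym (+-identityˡ 1#)
  diagonal-suc B-diagonal = 2≡1+1

  S-stairs : ∀ {d} {x : W p d} → InS p x → ∃₂ λ s t → Diagonal s t × ∃ λ k → x ≡ stairs s t k
  S-stairs {d} (i , refl) = ↑-induction {P = λ i → ∃₂ λ s t → Diagonal s t × ∃ λ k → Sfam p {d} i ≡ stairs s t k}
    (λ k → 1# , 0# , A-diagonal , k , Sfam-↑ˡ k)
    (λ k → 2# , 1# , B-diagonal , k , Sfam-↑ʳ k)
    i

  stairs-below-CommutatorOne : ∀ {d} {s t s′ t′} {k l : Fin d} → Diagonal s t → toℕ k < toℕ l →
    CommutatorOne (stairs s t k) (stairs s′ t′ l)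
  stairs-below-CommutatorOne {s = s} {t} {s′} {t′} {k} {l} diag k<l = stairs-CommutatorOne {s = s} {t} {s′} {t′} (ℕ.<⇒≤ k<l) (begin
    stair t′ l k * s      ≡⟨ cong (_* s) (stair-below t′ k<l) ⟩
    1# * s                ≡⟨ *-identityˡ s ⟩
    s                     ≡⟨ diagonal-suc diag ⟩
    t + 1#                ≡⟨ cong (_+ 1#) (*-identityʳ t) ⟨
    t * 1# + 1#           ≡⟨ cong (λ x → t * x + 1#) (stair-below s′ k<l) ⟨
    t * stair s′ l k + 1# ∎)
    where open ≡-Reasoning

  AB-CommutatorOne : ∀ {d} (k : Fin d) → CommutatorOne (stairs 1# 0# k) (stairs 2# 1# k)
  AB-CommutatorOne k = stairs-CommutatorOne {s = 1#} {0#} {2#} {1#} {k} {k} ℕ.≤-refl (begin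
    stair 1# k k * 1#     ≡⟨ trans (cong (_* 1#) (stair-at 1# k)) (*-identityʳ 1#) ⟩
    1#                    ≡⟨ trans (cong (_+ 1#) (zeroˡ (stair 2# k k))) (+-identityˡ 1#) ⟨
    0# * stair 2# k k + 1# ∎)
    where open ≡-Reasoning

  stairs-CommutatorOne-⊎ : ∀ {d} {s t s′ t′} {k l : Fin d} → Diagonal s t → Diagonal s′ t′ →
    stairs s t k ≢ stairs s′ t′ l →
    CommutatorOne (stairs s t k) (stairs s′ t′ l) ⊎ CommutatorOne (stairs s′ t′ l) (stairs s t k)
  stairs-CommutatorOne-⊎ {s = s} {t} {s′} {t′} {k} {l} diag diag′ x≢y with ℕ.<-cmp (toℕ k) (toℕ l)
  ... | tri< k<l _ _ = inj₁ (stairs-below-CommutatorOne {s′ = s′} {t′} diag k<l)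
  ... | tri> _ _ l<k = inj₂ (stairs-below-CommutatorOne {s′ = s} {t} diag′ l<k)
  ... | tri≈ _ k≡l _ with toℕ-injective k≡l | diag | diag′
  ...   | refl | A-diagonal | A-diagonal = ⊥-elim (x≢y refl)
  ...   | refl | A-diagonal | B-diagonal = inj₁ (AB-CommutatorOne k)
  ...   | refl | B-diagonal | A-diagonal = inj₂ (AB-CommutatorOne k)
  ...   | refl | B-diagonal | B-diagonal = ⊥-elim (x≢y refl)

  CommutatorOne⇒≢ : 1 < p → ∀ {d} {x y : W p d} → CommutatorOne x y → dot p (proj₂ x) (proj₁ y) ≢ dot p (proj₂ y) (proj₁ x)
  CommutatorOne⇒≢ 1<p {x = x} {y} one comm = 1≢0 1<p (+-cancelˡ X 1# 0# (begin
    X + 1#                         ≡⟨ one ⟨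
    dot p (proj₂ y) (proj₁ x)      ≡⟨ comm ⟨
    X                              ≡⟨ +-identityʳ X ⟨
    X + 0#                         ∎))
    where
    open ≡-Reasoning
    X = dot p (proj₂ x) (proj₁ y)

  S-noncommuting : 1 < p → ∀ {d} {x y : W p d} → InS p x → InS p y → x ≢ y →
    dot p (proj₂ x) (proj₁ y) ≢ dot p (proj₂ y) (proj₁ x)
  S-noncommuting 1<p x∈S y∈S x≢y with S-stairs x∈S | S-stairs y∈S
  ... | s , t , diag , k , refl | s′ , t′ , diag′ , l , refl with stairs-CommutatorOne-⊎ {s = s} {t} {s′} {t′} {k} {l} diag diag′ x≢y
  ...   | inj₁ one = CommutatorOne⇒≢ 1<p {x = stairs s t k} {stairs s′ t′ l} one
  ...   | inj₂ one = CommutatorOne⇒≢ 1<p {x = stairs s′ t′ l} {stairs s t k} one ∘ sym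

  mul₁-commute⇒dot≡ : ∀ {d} {x y : W p d} → mul₁ p (ε p x) (ε p y) ≡ mul₁ p (ε p y) (ε p x) →
    dot p (proj₂ x) (proj₁ y) ≡ dot p (proj₂ y) (proj₁ x)
  mul₁-commute⇒dot≡ comm = +-cancelˡ (0# + 0#) _ _ (cong (proj₂ ∘ proj₂) comm)

  φ-comm : ∀ u v → φ p u v ≡ φ p v u
  φ-comm u v = cong (λ n → if p ℕ.≤ᵇ n then 1# else 0#) (ℕ.+-comm (toℕ u) (toℕ v))

  mul₂-commute⇒dot≡ : ∀ {d} {x y : W p d} → mul₂ p (ε p x) (ε p y) ≡ mul₂ p (ε p y) (ε p x) →
    dot p (proj₂ x) (proj₁ y) ≡ dot p (proj₂ y) (proj₁ x)
  mul₂-commute⇒dot≡ {x = x} {y} comm = +-cancelˡ (0# + 0#) _ _ (+-cancelʳ (φ p a b) _ _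
    (trans (cong (proj₂ ∘ proj₂) comm) (cong (0# + 0# + dot p (proj₂ y) (proj₁ x) +_) (φ-comm b a))))
    where
    a = first p (proj₁ x)
    b = first p (proj₁ y)

  noTwoCommute₁ : 1 < p → ∀ {d} → NoTwoCommute p (mul₁ p {d})
  noTwoCommute₁ 1<p x y x∈S y∈S εx≢εy = S-noncommuting 1<p x∈S y∈S (εx≢εy ∘ cong (ε p)) ∘ mul₁-commute⇒dot≡

  noTwoCommute₂ : 1 < p → ∀ {d} → NoTwoCommute p (mul₂ p {d})
  noTwoCommute₂ 1<p x y x∈S y∈S εx≢εy = S-noncommuting 1<p x∈S y∈S (εx≢εy ∘ cong (ε p)) ∘ mul₂-commute⇒dot≡

lemma5p1 : (p : ℕ) .{{_ : NonZero p}} → Prime p → ¬ (2 ∣ p) → (d : ℕ) → 1 ≤ d →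
    IsBasis p (Sfam p {d}) × (NoTwoCommute p (mul₁ p {d}) × NoTwoCommute p (mul₂ p {d}))
lemma5p1 p p-prime _ d _ = (linearlyIndependent p , spanning p) , noTwoCommute₁ p 1<p , noTwoCommute₂ p 1<p
  where
  1<p : 1 < p
  1<p = nonTrivial⇒n>1 p {{prime⇒nonTrivial p-prime}}
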